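{- Let $I$ be a finite set and $\pi=\{\pi^1,\dots,\pi^l\}$ a set partition of $I$, with $p_i=|\pi^i|$. Then for every positive integer $n$, $\chi^{\Pi}_I(\pi)(n)=\prod_{i=1}^l p_i!\binom{n}{p_i}$.
   Context: Hopf monoid $\Pi$ of set partitions: for $I=S\sqcup T$, product is union of partitions and coproduct is $\pi\mapsto\pi|_S\otimes\pi|_T$, where $\pi|_S$ is the partition of $S$ formed by the nonempty intersections of the parts of $\pi$ with $S$. A partition is discrete if all its parts are singletons. $\Delta_{S_1,\dots,S_n}$ is the iterated coproduct for a decomposition $(S_1,\dots,S_n)$ of $I$ (pairwise disjoint, possibly empty, union $I$). The basic invariant $\chi^{\Pi}_I(\pi)(n)$ is the number of decompositions $(S_1,\dots,S_n)$ of $I$ of length $n$ such that every tensor factor of $\Delta_{S_1,\dots,S_n}(\pi)$ is discrete. -}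

module Defs where

open import Data.Nat using (ℕ; zero; suc; _*_; _!)
open import Data.Nat.Combinatorics using (_C_)
open import Data.Fin using (Fin)
open import Data.Fin.Properties using (all?; _≟_)
open import Data.Vec using (Vec; []; _∷_; lookup)
open import Data.List using (List; []; _∷_; [_]; map; concatMap; filter; length; allFin)
open import Data.Product using (Σ)
open import Function.Definitions using (Surjective)
open import Relation.Binary.PropositionalEquality using (_≡_)
open import Relation.Nullary using (Dec)
open import Relation.Nullary.Decidable using (_→-dec_)

-- A set partition of the finite set I = Fin m into l blocks π¹,…,πˡ,
-- encoded by the block-membership map  block : Fin m → Fin l,
-- surjective so that every block is nonempty.
record Partition (m : ℕ) : Set where
  field
    l     : ℕ
    block : Fin m → Fin l
    surj  : Surjective _≡_ _≡_ block
open Partition public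

blockSize : ∀ {m} (π : Partition m) → Fin (l π) → ℕ
blockSize {m} π i = length (filter (λ x → block π x ≟ i) (allFin m))

-- A decomposition (S_1,…,S_n) of Fin m (pairwise disjoint, possibly empty,
-- covering) is encoded by the vector d assigning to each x the index j with x ∈ S_j.
Decomposition : ℕ → ℕ → Set
Decomposition m n = Vec (Fin n) m

allDecomps : (m n : ℕ) → List (Decomposition m n)
allDecomps zero    n = [ [] ]
allDecomps (suc m) n = concatMap (λ v → map (_∷ v) (allFin n)) (allDecomps m n)

-- π|_S discrete, for S = S_j = { x | d x = j }: every nonempty intersection
-- of a block of π with S is a singleton, i.e. two elements of S in the same
-- block of π are equal.
RestrictionDiscrete : ∀ {m n} → Partition m → Decomposition m n → Fin n → Set
RestrictionDiscrete {m} π d j =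
  ∀ (x y : Fin m) → lookup d x ≡ j → lookup d y ≡ j → block π x ≡ block π y → x ≡ y

AllFactorsDiscrete : ∀ {m n} → Partition m → Decomposition m n → Set
AllFactorsDiscrete {m} {n} π d = ∀ (j : Fin n) → RestrictionDiscrete π d j

allFactorsDiscrete? : ∀ {m n} (π : Partition m) (d : Decomposition m n) → Dec (AllFactorsDiscrete π d)
allFactorsDiscrete? π d = all? λ j → all? λ x → all? λ y →
  (lookup d x ≟ j) →-dec ((lookup d y ≟ j) →-dec ((block π x ≟ block π y) →-dec (x ≟ y)))

χΠ : ∀ {m} → Partition m → ℕ → ℕ
χΠ {m} π n = length (filter (allFactorsDiscrete? π) (allDecomps m n))

-- A decomposition (S_1,…,S_n) of I is a colouring d : I → [n], and every π|_{S_j} is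
-- discrete exactly when d is injective on every block of π. Colour the elements one at a
-- time. Deleting an element x from a colouring that is injective on every block leaves
-- such a colouring, and conversely such a colouring of the remaining elements extends in
-- exactly n − k ways, where k is the number of other elements in the block of x: the
-- colour of x must avoid the k (distinct) colours already used on that block. Inductively
-- each block of size p contributes the falling factorial n (n − 1) ⋯ (n − p + 1) = p! (n choose p).

module Submission where

open import Algebra.Properties.CommutativeSemigroup using (x∙yz≈y∙xz)
open import Data.Empty using (⊥-elim)
open import Data.Fin using (Fin; zero; suc)
open import Data.Fin.Properties using (_≟_; all?; suc-injective)
open import Data.List using (List; []; _∷_; _++_; map; filter; length; concatMap; tabulate; allFin)
open import Data.List.Membership.Propositional using (_∈_; _∉_)
open import Data.List.Membership.Propositional.Properties
  using (∈-map⁺; ∈-map⁻; ∈-filter⁺; ∈-filter⁻; ∈-allFin)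
import Data.List.Membership.DecPropositional as DecMembership
open import Data.List.Properties
  using (filter-++; filter-accept; filter-reject; filter-none; filter-≐;
         length-++; length-map; length-tabulate; map-tabulate; tabulate-cong)
open import Data.List.Relation.Unary.All as All using (All; []; _∷_)
import Data.List.Relation.Unary.All.Properties as All
open import Data.List.Relation.Unary.Any using (here; there)
open import Data.List.Relation.Unary.Unique.Propositional using (Unique; []; _∷_)
import Data.List.Relation.Unary.Unique.Propositional.Properties as Unique
open import Data.Nat using (ℕ; zero; suc; _+_; _*_; _∸_; _≤_; _<_; s≤s; _≤?_; _!)
open import Data.Nat.Combinatorics using (_C_; nCk≡nPk/k!; k>n⇒nCk≡0)
open import Data.Nat.Combinatorics.Base using (_P_; _P′_)
open import Data.Nat.Combinatorics.Specification using (nPk≡n!/[n∸k]!; nP′k≡n!/[n∸k]!; k!∣nP′k)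
open import Data.Nat.DivMod using (_/_; m*[n/m]≡n)
open import Data.Nat.ListAction using (sum; product)
open import Data.Nat.Properties
  using (+-suc; *-assoc; *-comm; *-zeroʳ; *-commutativeSemigroup; m+n∸m≡n; m≤n⇒m∸n≡0; ≰⇒>; _!≢0)
open import Data.Product using (_,_; proj₂)
open import Data.Sum using (_⊎_; inj₁; inj₂)
open import Data.Vec using (Vec; []; _∷_; lookup)
open import Function using (_∘_; id)
open import Level using (Level)
open import Relation.Binary.Definitions using (DecidableEquality)
open import Relation.Binary.PropositionalEquality
  using (_≡_; _≢_; refl; sym; trans; cong; cong₂; subst; module ≡-Reasoning)
open import Relation.Nullary using (Dec; yes; no; ¬_)
open import Relation.Nullary.Decidable using (_→-dec_)
open import Relation.Unary using (Pred; Decidable; _⊥_; _≐_)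
open import Relation.Unary.Properties using (∁?; _∪?_)

open import Defs

private variable
  a p q : Level
  A B : Set a
  m n : ℕ

module _ {P : Pred A p} (P? : Decidable P) where

  filter-map : (f : B → A) (xs : List B) → filter P? (map f xs) ≡ map f (filter (P? ∘ f) xs)
  filter-map f [] = refl
  filter-map f (x ∷ xs) with P? (f x)
  ... | yes _ = cong (f x ∷_) (filter-map f xs)
  ... | no _  = filter-map f xs

  length-filter-map : (f : B → A) (xs : List B) →
    length (filter P? (map f xs)) ≡ length (filter (P? ∘ f) xs)
  length-filter-map f xs = trans (cong length (filter-map f xs)) (length-map f (filter (P? ∘ f) xs))

  length-filter-concatMap : (f : B → List A) (xs : List B) →
    length (filter P? (concatMap f xs)) ≡ sum (map (λ x → length (filter P? (f x))) xs)
  length-filter-concatMap f [] = refl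
  length-filter-concatMap f (x ∷ xs) = begin
    length (filter P? (f x ++ concatMap f xs))
      ≡⟨ cong length (filter-++ P? (f x) (concatMap f xs)) ⟩
    length (filter P? (f x) ++ filter P? (concatMap f xs))
      ≡⟨ length-++ (filter P? (f x)) ⟩
    length (filter P? (f x)) + length (filter P? (concatMap f xs))
      ≡⟨ cong (length (filter P? (f x)) +_) (length-filter-concatMap f xs) ⟩
    sum (map (λ x → length (filter P? (f x))) (x ∷ xs)) ∎
    where open ≡-Reasoning

  length-filter+length-filter-∁ : ∀ xs →
    length (filter P? xs) + length (filter (∁? P?) xs) ≡ length xs
  length-filter+length-filter-∁ [] = refl
  length-filter+length-filter-∁ (x ∷ xs) with P? x
  ... | yes _ = cong suc (length-filter+length-filter-∁ xs)
  ... | no _  = trans (+-suc _ _) (cong suc (length-filter+length-filter-∁ xs))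

  sum-map≡length-filter* : (h : A → ℕ) (c : ℕ) →
    (∀ x → P x → h x ≡ c) → (∀ x → ¬ P x → h x ≡ 0) →
    ∀ xs → sum (map h xs) ≡ length (filter P? xs) * c
  sum-map≡length-filter* h c onP offP [] = refl
  sum-map≡length-filter* h c onP offP (x ∷ xs) with P? x
  ... | yes px = cong₂ _+_ (onP x px) (sum-map≡length-filter* h c onP offP xs)
  ... | no ¬px = cong₂ _+_ (offP x ¬px) (sum-map≡length-filter* h c onP offP xs)

module _ {P : Pred A p} {Q : Pred A q} (P? : Decidable P) (Q? : Decidable Q) where

  length-filter-∪ : P ⊥ Q → ∀ xs →
    length (filter (P? ∪? Q?) xs) ≡ length (filter P? xs) + length (filter Q? xs)
  length-filter-∪ disj [] = refl
  length-filter-∪ disj (x ∷ xs) with P? x | Q? x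
  ... | yes px | yes qx = ⊥-elim (disj (px , qx))
  ... | yes _  | no _   = cong suc (length-filter-∪ disj xs)
  ... | no _   | yes _  = trans (cong suc (length-filter-∪ disj xs)) (sym (+-suc _ _))
  ... | no _   | no _   = length-filter-∪ disj xs

unique-map⁺ : {f : A → B} {xs : List A} → (∀ {x y} → x ∈ xs → y ∈ xs → f x ≡ f y → x ≡ y) →
  Unique xs → Unique (map f xs)
unique-map⁺ inj [] = []
unique-map⁺ inj (x∉xs ∷ u) =
  All.map⁺ (All.tabulate λ y∈xs fx≡fy → All.lookup x∉xs y∈xs (inj (here refl) (there y∈xs) fx≡fy))
  ∷ unique-map⁺ (λ x∈xs y∈xs → inj (there x∈xs) (there y∈xs)) u

module _ (_≟ᴬ_ : DecidableEquality A) where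

  open DecMembership _≟ᴬ_ using (_∈?_)

  length-filter-≡ : ∀ {xs} {y : A} → Unique xs → y ∈ xs → length (filter (_≟ᴬ y) xs) ≡ 1
  length-filter-≡ {x ∷ xs} (x∉xs ∷ _) (here refl) = begin
    length (filter (_≟ᴬ x) (x ∷ xs)) ≡⟨ cong length (filter-accept (_≟ᴬ x) refl) ⟩
    suc (length (filter (_≟ᴬ x) xs)) ≡⟨ cong (suc ∘ length) (filter-none (_≟ᴬ x) (All.map (_∘ sym) x∉xs)) ⟩
    1                                 ∎
    where open ≡-Reasoning
  length-filter-≡ {x ∷ xs} {y} (x∉xs ∷ u) (there y∈xs) =
    trans (cong length (filter-reject (_≟ᴬ y) (All.lookup x∉xs y∈xs)))
          (length-filter-≡ u y∈xs)

  length-filter-∈ : ∀ {xs ys} → Unique xs → Unique ys → All (_∈ xs) ys →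
    length (filter (_∈? ys) xs) ≡ length ys
  length-filter-∈ {xs} {[]} _ _ _ = cong length (filter-none (_∈? []) (All.universal (λ _ ()) xs))
  length-filter-∈ {xs} {y ∷ ys} uxs (y∉ys ∷ uys) (y∈xs ∷ ys⊆xs) = begin
    length (filter (_∈? (y ∷ ys)) xs)
      ≡⟨ cong length (filter-≐ (_∈? (y ∷ ys)) ((_≟ᴬ y) ∪? (_∈? ys)) (split , join) xs) ⟩
    length (filter ((_≟ᴬ y) ∪? (_∈? ys)) xs)
      ≡⟨ length-filter-∪ (_≟ᴬ y) (_∈? ys) (λ { (refl , y∈ys) → All.All¬⇒¬Any y∉ys y∈ys }) xs ⟩
    length (filter (_≟ᴬ y) xs) + length (filter (_∈? ys) xs)
      ≡⟨ cong₂ _+_ (length-filter-≡ uxs y∈xs) (length-filter-∈ uxs uys ys⊆xs) ⟩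
    suc (length ys) ∎
    where
    open ≡-Reasoning
    split : ∀ {v} → v ∈ y ∷ ys → v ≡ y ⊎ v ∈ ys
    split (here v≡y)   = inj₁ v≡y
    split (there v∈ys) = inj₂ v∈ys
    join : ∀ {v} → v ≡ y ⊎ v ∈ ys → v ∈ y ∷ ys
    join (inj₁ v≡y)  = here v≡y
    join (inj₂ v∈ys) = there v∈ys

  length-filter-∉ : ∀ {xs ys} → Unique xs → Unique ys → All (_∈ xs) ys →
    length (filter (∁? (_∈? ys)) xs) ≡ length xs ∸ length ys
  length-filter-∉ {xs} {ys} uxs uys ys⊆xs = begin
    #∉
      ≡⟨ m+n∸m≡n (length ys) #∉ ⟨
    length ys + #∉ ∸ length ys
      ≡⟨ cong (λ k → k + #∉ ∸ length ys) (length-filter-∈ uxs uys ys⊆xs) ⟨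
    length (filter (_∈? ys) xs) + #∉ ∸ length ys
      ≡⟨ cong (_∸ length ys) (length-filter+length-filter-∁ (_∈? ys) xs) ⟩
    length xs ∸ length ys ∎
    where
    open ≡-Reasoning
    #∉ = length (filter (∁? (_∈? ys)) xs)

product-tabulate-1 : ∀ l → product (tabulate {n = l} (λ _ → 1)) ≡ 1
product-tabulate-1 zero    = refl
product-tabulate-1 (suc l) = cong (1 *_) (product-tabulate-1 l)

product-tabulate-scaleAt : ∀ {l} (g h : Fin l → ℕ) (k : Fin l) (c : ℕ) →
  g k ≡ c * h k → (∀ i → i ≢ k → g i ≡ h i) → product (tabulate g) ≡ c * product (tabulate h)
product-tabulate-scaleAt {suc l} g h zero c gk g≡h = begin
  g zero * product (tabulate (g ∘ suc))     ≡⟨ cong₂ _*_ gk (cong product (tabulate-cong λ i → g≡h (suc i) λ ())) ⟩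
  c * h zero * product (tabulate (h ∘ suc)) ≡⟨ *-assoc c _ _ ⟩
  c * product (tabulate h)                  ∎
  where open ≡-Reasoning
product-tabulate-scaleAt {suc l} g h (suc k) c gk g≡h = begin
  g zero * product (tabulate (g ∘ suc))       ≡⟨ cong₂ _*_ (g≡h zero λ ()) tail ⟩
  h zero * (c * product (tabulate (h ∘ suc))) ≡⟨ x∙yz≈y∙xz *-commutativeSemigroup (h zero) c _ ⟩
  c * product (tabulate h)                    ∎
  where
  open ≡-Reasoning
  tail : product (tabulate (g ∘ suc)) ≡ c * product (tabulate (h ∘ suc))
  tail = product-tabulate-scaleAt (g ∘ suc) (h ∘ suc) k c gk
           λ i i≢k → g≡h (suc i) (i≢k ∘ suc-injective)

k!*nCk≡nP′k : ∀ n k → k ! * (n C k) ≡ n P′ k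
k!*nCk≡nP′k n k with k ≤? n
... | yes k≤n = begin
  k ! * (n C k)                   ≡⟨ cong (k ! *_) (nCk≡nPk/k! k≤n) ⟩
  k ! * ((n P k) / k !)           ≡⟨ cong (λ t → k ! * (t / k !)) nPk≡nP′k ⟩
  k ! * ((n P′ k) / k !)          ≡⟨ m*[n/m]≡n (k!∣nP′k k≤n) ⟩
  n P′ k                          ∎
  where
  open ≡-Reasoning
  instance _ = k !≢0
  nPk≡nP′k : n P k ≡ n P′ k
  nPk≡nP′k = trans (nPk≡n!/[n∸k]! k≤n) (sym (nP′k≡n!/[n∸k]! k≤n))
... | no k≰n = begin
  k ! * (n C k) ≡⟨ cong (k ! *_) (k>n⇒nCk≡0 (≰⇒> k≰n)) ⟩
  k ! * 0       ≡⟨ *-zeroʳ (k !) ⟩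
  0             ≡⟨ nP′k≡0 (≰⇒> k≰n) ⟨
  n P′ k        ∎
  where
  open ≡-Reasoning
  nP′k≡0 : ∀ {k} → n < k → n P′ k ≡ 0
  nP′k≡0 {suc k} (s≤s n≤k) = cong (_* (n P′ k)) (m≤n⇒m∸n≡0 n≤k)

-- Stated for an arbitrary block map b rather than a Partition, because deleting an element
-- can empty a block, so surjectivity does not survive the induction.
module _ {l : ℕ} where

  fibre : (Fin m → Fin l) → Fin l → List (Fin m)
  fibre {m} b i = filter (λ x → b x ≟ i) (allFin m)

  fibreSize : (Fin m → Fin l) → Fin l → ℕ
  fibreSize b i = length (fibre b i)

  fibreColours : (Fin m → Fin l) → Vec (Fin n) m → Fin l → List (Fin n)
  fibreColours b d i = map (lookup d) (fibre b i)

  InjectiveOnFibres : (Fin m → Fin l) → Vec (Fin n) m → Set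
  InjectiveOnFibres b d = ∀ x y → b x ≡ b y → lookup d x ≡ lookup d y → x ≡ y

  injectiveOnFibres? : (b : Fin m → Fin l) (d : Vec (Fin n) m) → Dec (InjectiveOnFibres b d)
  injectiveOnFibres? b d =
    all? λ x → all? λ y → (b x ≟ b y) →-dec ((lookup d x ≟ lookup d y) →-dec (x ≟ y))

  countInjectiveOnFibres : (Fin m → Fin l) → ℕ → ℕ
  countInjectiveOnFibres {m} b n = length (filter (injectiveOnFibres? b) (allDecomps m n))

  fibreSize-tail : (b : Fin (suc m) → Fin l) (i : Fin l) →
    length (filter (λ x → b x ≟ i) (tabulate suc)) ≡ fibreSize (b ∘ suc) i
  fibreSize-tail {m} b i = trans (cong (length ∘ filter (λ x → b x ≟ i)) (sym (map-tabulate id suc)))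
                                 (length-filter-map (λ x → b x ≟ i) suc (allFin m))

  fibreSize-suc-≡ : (b : Fin (suc m) → Fin l) {i : Fin l} → b zero ≡ i →
    fibreSize b i ≡ suc (fibreSize (b ∘ suc) i)
  fibreSize-suc-≡ b {i} b0≡i =
    trans (cong length (filter-accept (λ x → b x ≟ i) b0≡i)) (cong suc (fibreSize-tail b i))

  fibreSize-suc-≢ : (b : Fin (suc m) → Fin l) {i : Fin l} → b zero ≢ i →
    fibreSize b i ≡ fibreSize (b ∘ suc) i
  fibreSize-suc-≢ b {i} b0≢i =
    trans (cong length (filter-reject (λ x → b x ≟ i) b0≢i)) (fibreSize-tail b i)

  ∈-fibre⁻ : {b : Fin m → Fin l} {i : Fin l} {x : Fin m} → x ∈ fibre b i → b x ≡ i
  ∈-fibre⁻ {m} {b} {i} x∈ = proj₂ (∈-filter⁻ (λ x → b x ≟ i) {xs = allFin m} x∈)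

  ∈-fibreColours⁺ : (b : Fin m → Fin l) (d : Vec (Fin n) m) {i : Fin l} {x : Fin m} →
    b x ≡ i → lookup d x ∈ fibreColours b d i
  ∈-fibreColours⁺ b d {i} {x} bx≡i = ∈-map⁺ (lookup d) (∈-filter⁺ (λ y → b y ≟ i) (∈-allFin x) bx≡i)

  fibreColours-unique : (b : Fin m → Fin l) (d : Vec (Fin n) m) → InjectiveOnFibres b d →
    ∀ i → Unique (fibreColours b d i)
  fibreColours-unique {m} b d inj i =
    unique-map⁺ (λ x∈ y∈ → inj _ _ (trans (∈-fibre⁻ x∈) (sym (∈-fibre⁻ y∈))))
                (Unique.filter⁺ (λ x → b x ≟ i) (Unique.allFin⁺ m))

  module _ (b : Fin (suc m) → Fin l) (v : Fin n) (d : Vec (Fin n) m) where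

    injectiveOnFibres-tail : InjectiveOnFibres b (v ∷ d) → InjectiveOnFibres (b ∘ suc) d
    injectiveOnFibres-tail inj x y bx≡by dx≡dy = suc-injective (inj (suc x) (suc y) bx≡by dx≡dy)

    injectiveOnFibres-head : InjectiveOnFibres b (v ∷ d) → v ∉ fibreColours (b ∘ suc) d (b zero)
    injectiveOnFibres-head inj v∈ with ∈-map⁻ (lookup d) v∈
    ... | x , x∈ , v≡dx with inj zero (suc x) (sym (∈-fibre⁻ x∈)) v≡dx
    ... | ()

    injectiveOnFibres-∷ : InjectiveOnFibres (b ∘ suc) d → v ∉ fibreColours (b ∘ suc) d (b zero) →
      InjectiveOnFibres b (v ∷ d)
    injectiveOnFibres-∷ inj v∉ zero    zero    _     _     = refl
    injectiveOnFibres-∷ inj v∉ zero    (suc y) b0≡by v≡dy =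
      ⊥-elim (v∉ (subst (_∈ _) (sym v≡dy) (∈-fibreColours⁺ (b ∘ suc) d (sym b0≡by))))
    injectiveOnFibres-∷ inj v∉ (suc x) zero    bx≡b0 dx≡v =
      ⊥-elim (v∉ (subst (_∈ _) dx≡v (∈-fibreColours⁺ (b ∘ suc) d bx≡b0)))
    injectiveOnFibres-∷ inj v∉ (suc x) (suc y) bx≡by dx≡dy = cong suc (inj x y bx≡by dx≡dy)

  module _ (b : Fin (suc m) → Fin l) (d : Vec (Fin n) m) where

    extensions : ℕ
    extensions = length (filter (injectiveOnFibres? b) (map (_∷ d) (allFin n)))

    extensions-injective : InjectiveOnFibres (b ∘ suc) d →
      extensions ≡ n ∸ fibreSize (b ∘ suc) (b zero)
    extensions-injective inj = begin
      extensions
        ≡⟨ length-filter-map (injectiveOnFibres? b) (_∷ d) (allFin n) ⟩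
      length (filter (λ v → injectiveOnFibres? b (v ∷ d)) (allFin n))
        ≡⟨ cong length (filter-≐ _ _ (injectiveOnFibres-head b _ d , injectiveOnFibres-∷ b _ d inj) (allFin n)) ⟩
      length (filter (∁? (_∈? colours)) (allFin n))
        ≡⟨ length-filter-∉ _≟_ (Unique.allFin⁺ n) (fibreColours-unique (b ∘ suc) d inj (b zero))
                              (All.universal ∈-allFin colours) ⟩
      length (allFin n) ∸ length colours
        ≡⟨ cong₂ _∸_ (length-tabulate id) (length-map (lookup d) (fibre (b ∘ suc) (b zero))) ⟩
      n ∸ fibreSize (b ∘ suc) (b zero) ∎
      where
      open ≡-Reasoning
      open DecMembership (_≟_ {n}) using (_∈?_)
      colours = fibreColours (b ∘ suc) d (b zero)

    extensions-nonInjective : ¬ InjectiveOnFibres (b ∘ suc) d → extensions ≡ 0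
    extensions-nonInjective ¬inj = trans (length-filter-map (injectiveOnFibres? b) (_∷ d) (allFin n))
      (cong length (filter-none _ (All.universal (λ v → ¬inj ∘ injectiveOnFibres-tail b v d) (allFin n))))

  countInjectiveOnFibres-suc : (b : Fin (suc m) → Fin l) (n : ℕ) →
    countInjectiveOnFibres b n
      ≡ countInjectiveOnFibres (b ∘ suc) n * (n ∸ fibreSize (b ∘ suc) (b zero))
  countInjectiveOnFibres-suc {m} b n =
    trans (length-filter-concatMap (injectiveOnFibres? b) (λ d → map (_∷ d) (allFin n)) (allDecomps m n))
          (sum-map≡length-filter* (injectiveOnFibres? (b ∘ suc)) (extensions b) _
             (extensions-injective b) (extensions-nonInjective b) (allDecomps m n))

  countInjectiveOnFibres≡product : (b : Fin m → Fin l) (n : ℕ) →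
    countInjectiveOnFibres b n ≡ product (tabulate (λ i → n P′ fibreSize b i))
  countInjectiveOnFibres≡product {zero} b n = sym (product-tabulate-1 l)
  countInjectiveOnFibres≡product {suc m} b n = begin
    countInjectiveOnFibres b n
      ≡⟨ countInjectiveOnFibres-suc b n ⟩
    countInjectiveOnFibres (b ∘ suc) n * (n ∸ k)
      ≡⟨ cong (_* (n ∸ k)) (countInjectiveOnFibres≡product (b ∘ suc) n) ⟩
    product (tabulate (λ i → n P′ fibreSize (b ∘ suc) i)) * (n ∸ k)
      ≡⟨ *-comm _ (n ∸ k) ⟩
    (n ∸ k) * product (tabulate (λ i → n P′ fibreSize (b ∘ suc) i))
      ≡⟨ product-tabulate-scaleAt _ _ (b zero) (n ∸ k) atZero elsewhere ⟨
    product (tabulate (λ i → n P′ fibreSize b i)) ∎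
    where
    open ≡-Reasoning
    k = fibreSize (b ∘ suc) (b zero)
    atZero : n P′ fibreSize b (b zero) ≡ (n ∸ k) * (n P′ k)
    atZero = cong (n P′_) (fibreSize-suc-≡ b refl)
    elsewhere : ∀ i → i ≢ b zero → n P′ fibreSize b i ≡ n P′ fibreSize (b ∘ suc) i
    elsewhere i i≢b0 = cong (n P′_) (fibreSize-suc-≢ b (i≢b0 ∘ sym))

allFactorsDiscrete≐injectiveOnFibres : (π : Partition m) →
  AllFactorsDiscrete {n = n} π ≐ InjectiveOnFibres (block π)
allFactorsDiscrete≐injectiveOnFibres π =
  (λ discrete x y bx≡by dx≡dy → discrete _ x y refl (sym dx≡dy) bx≡by) ,
  (λ inj j x y dx≡j dy≡j bx≡by → inj x y bx≡by (trans dx≡j (sym dy≡j)))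

mainTheorem10 : (m : ℕ) (π : Partition m) (n : ℕ) → 1 ≤ n →
    χΠ π n ≡ product (map (λ i → (blockSize π i) ! * (n C blockSize π i)) (allFin (l π)))
mainTheorem10 m π n _ = begin
  χΠ π n
    ≡⟨ cong length (filter-≐ (allFactorsDiscrete? π) (injectiveOnFibres? (block π))
                             (allFactorsDiscrete≐injectiveOnFibres π) (allDecomps m n)) ⟩
  countInjectiveOnFibres (block π) n
    ≡⟨ countInjectiveOnFibres≡product (block π) n ⟩
  product (tabulate (λ i → n P′ blockSize π i))
    ≡⟨ cong product (tabulate-cong λ i → k!*nCk≡nP′k n (blockSize π i)) ⟨
  product (tabulate (λ i → blockSize π i ! * (n C blockSize π i)))
    ≡⟨ cong product (map-tabulate id (λ i → blockSize π i ! * (n C blockSize π i))) ⟨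
  product (map (λ i → blockSize π i ! * (n C blockSize π i)) (allFin (l π))) ∎
  where open ≡-Reasoning
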